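{- Let $n\ge1$ and $\mathbf c=(c_1,\dots,c_{n-1})\in\mathbb{Z}_{\ge0}^{n-1}$ with $\sum_ic_i=n-1$. The pairs $(T,lr)$ of content $\mathbf c$ are in bijection with the pairs $P=(T',\rho)$ where $T'$ is an indexed tree with support $\{1,\dots,n-1\}$, $\rho\in\mathsf{LBS}(T')$, and the set of node labels of $\rho$ is exactly $\mathbb{Z}_{\mathbf c}$.
   Context: A pair $(T,lr)$ of content $\mathbf c$ consists of a complete binary tree $T$ with $n-1$ internal nodes (hence $n$ leaves) and a bijection $lr$ from the set of internal nodes and leaves of $T$ to $\{1,\dots,2n-1\}$ such that every internal node has label strictly larger than that of its left child and strictly smaller than that of its right child (children may be leaves), and the leaf labels from left to right are $\ell_1<\cdots<\ell_n$ with $\ell_i=i+c_1+\cdots+c_{i-1}$. $\overline{\mathbb{Z}}$ is the set of symbols $(i,j)$, $i\in\mathbb{Z}$, $j\ge1$, ordered lexicographically, with $\mathrm{val}(i,j)=i$, and $\mathbb{Z}_{\mathbf c}=\{(i,j):1\le i\le n-1,\ 1\le j\le c_i\}$. An indexed tree with support $[1,n-1]$ is a plane binary tree with $n-1$ nodes, canonically labeled by $1,\dots,n-1$ in inorder; $\mathrm{INT}(u,T')$ is the set of canonical labels of the subtree rooted at $u$. $\mathsf{LBS}(T')$ is the set of injective $\rho$ from the nodes to $\overline{\mathbb{Z}}$ with $\rho(\text{left child of }u)<\rho(u)<\rho(\text{right child of }u)$ and $\mathrm{val}(\rho(u))\in\mathrm{INT}(u,T')$. -}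

module Defs where

open import Data.Nat using (ℕ; zero; suc; _+_; _*_; _≤_; _<_)
open import Data.Integer as ℤ using (ℤ; +_)
open import Data.Fin using (Fin; toℕ)
open import Data.List using (List; []; _∷_; _++_; [_])
open import Data.Vec as Vec using (Vec)
open import Data.Product using (Σ; _×_; _,_; proj₁; proj₂; ∃)
open import Data.Sum using (_⊎_)
open import Data.Unit using (⊤)
open import Data.List.Relation.Unary.All using (All)
open import Data.List.Relation.Unary.Unique.Propositional using (Unique)
open import Data.List.Membership.Propositional using (_∈_)
open import Relation.Binary.PropositionalEquality using (_≡_)

-- Pairs (T , lr): a complete binary tree whose vertices (internal nodes
-- and leaves) carry natural-number labels.

data LTree : Set where
  leaf : ℕ → LTree
  node : LTree → ℕ → LTree → LTree

rootLabel : LTree → ℕ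
rootLabel (leaf a)     = a
rootLabel (node _ a _) = a

allLabels : LTree → List ℕ
allLabels (leaf a)     = [ a ]
allLabels (node l a r) = allLabels l ++ (a ∷ allLabels r)

leafLabels : LTree → List ℕ
leafLabels (leaf a)     = [ a ]
leafLabels (node l _ r) = leafLabels l ++ leafLabels r

data NodeCondition : LTree → Set where
  leaf : ∀ a → NodeCondition (leaf a)
  node : ∀ {l a r} → rootLabel l < a → a < rootLabel r →
         NodeCondition l → NodeCondition r → NodeCondition (node l a r)

-- ℓ₁ , … , ℓₙ  with  ℓᵢ = i + c₁ + ⋯ + c_{i-1}
ellsFrom : ℕ → List ℕ → List ℕ
ellsFrom s []       = [ s ]
ellsFrom s (c ∷ cs) = s ∷ ellsFrom (s + suc c) cs

ells : ∀ {m} → Vec ℕ m → List ℕ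
ells c = ellsFrom 1 (Vec.toList c)

-- n = suc m ; the content c = (c₁,…,c_{n-1}) is a Vec ℕ m.
-- lr is a bijection onto {1,…,2n-1} = {1,…,2m+1}.
IsPairTLR : (m : ℕ) → Vec ℕ m → LTree → Set
IsPairTLR m c t =
  NodeCondition t ×
  Unique (allLabels t) ×
  All (λ k → 1 ≤ k × k ≤ 2 * m + 1) (allLabels t) ×
  (∀ k → 1 ≤ k → k ≤ 2 * m + 1 → k ∈ allLabels t) ×
  leafLabels t ≡ ells c

-- Z̄ : symbols (i , j), i ∈ ℤ, j ≥ 1 (the condition j ≥ 1 is imposed in LBS),
-- ordered lexicographically; val (i , j) = i.

ZBar : Set
ZBar = ℤ × ℕ

val : ZBar → ℤ
val = proj₁

data _<Z̄_ : ZBar → ZBar → Set where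
  fst< : ∀ {i i' j j'} → i ℤ.< i' → (i , j) <Z̄ (i' , j')
  snd< : ∀ {i j j'} → j < j' → (i , j) <Z̄ (i , j')

-- A plane binary tree (indexed tree; canonical inorder labels are implicit)
-- together with a decoration ρ of its nodes by elements of Z̄.
data RTree : Set where
  empty : RTree
  node  : RTree → ZBar → RTree → RTree

size : RTree → ℕ
size empty        = 0
size (node l _ r) = size l + suc (size r)

decorations : RTree → List ZBar
decorations empty        = []
decorations (node l x r) = decorations l ++ (x ∷ decorations r)

LeftOK : RTree → ZBar → Set
LeftOK empty        x = ⊤
LeftOK (node _ y _) x = y <Z̄ x

RightOK : ZBar → RTree → Set
RightOK x empty        = ⊤
RightOK x (node _ y _) = x <Z̄ y

-- LBSAt o t : the local conditions of LBS for a subtree t whose canonical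
-- (inorder) labels are o+1, …, o + size t; so INT(u) = [o+1, o+size t]
-- for the root u of t.
data LBSAt : ℕ → RTree → Set where
  empty : ∀ {o} → LBSAt o empty
  node  : ∀ {o l i j r} →
          1 ≤ j →
          LeftOK l (i , j) → RightOK (i , j) r →
          + suc o ℤ.≤ i → i ℤ.≤ + (o + size (node l (i , j) r)) →
          LBSAt o l → LBSAt (o + suc (size l)) r →
          LBSAt o (node l (i , j) r)

InLBS : RTree → Set
InLBS t = LBSAt 0 t × Unique (decorations t)

InZc : ∀ {m} → Vec ℕ m → ZBar → Set
InZc {m} c (i , j) = Σ (Fin m) λ k → i ≡ + suc (toℕ k) × 1 ≤ j × j ≤ Vec.lookup c k

IsPairP : (m : ℕ) → Vec ℕ m → RTree → Set
IsPairP m c t =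
  size t ≡ m ×
  InLBS t ×
  (∀ x → x ∈ decorations t → InZc c x) ×
  (∀ x → InZc c x → x ∈ decorations t)

-- A bijection between the subsets {a | P a} and {b | Q b}
-- (elements compared by their underlying objects, not the proofs).

record SubsetBijection {A B : Set} (P : A → Set) (Q : B → Set) : Set where
  field
    to       : Σ A P → Σ B Q
    from     : Σ B Q → Σ A P
    to-cong  : ∀ x y → proj₁ x ≡ proj₁ y → proj₁ (to x) ≡ proj₁ (to y)
    from-cong : ∀ x y → proj₁ x ≡ proj₁ y → proj₁ (from x) ≡ proj₁ (from y)
    from-to  : ∀ x → proj₁ (from (to x)) ≡ proj₁ x
    to-from  : ∀ y → proj₁ (to (from y)) ≡ proj₁ y

-- A label k ∈ [1, 2n − 1] that is not a leaf label lies strictly between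
-- two consecutive leaf labels, k = ℓᵢ + j with 1 ≤ j ≤ cᵢ; call (i , j) ∈ Z_c its symbol.
-- Since the leaf labels increase from left to right, k ↦ (i , j) is an order isomorphism
-- from the internal labels onto Z_c. Deleting the leaves of T and replacing each internal
-- label by its symbol gives (T′ , ρ): if o + 1, …, o + s are the inorder labels of the
-- subtree of T′ rooted at u, then the leaves below u in T are ℓ_{o+1}, …, ℓ_{o+s+1}, and
-- the node condition at u, propagated to the outermost of these leaves, says precisely
-- that val ρ(u) ∈ INT(u, T′); the child conditions become the order conditions of LBS.
-- Conversely (T′ , ρ) determines T by re-attaching leaves labelled ℓ₁, …, ℓₙ in order.
module Submission where

open import Defs
open import Data.Nat using (ℕ; zero; suc; _+_; _*_; _∸_; _≤_; _<_; z≤n; s≤s; z<s; s<s; _<?_; _≟_)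
open import Data.Nat.Properties
open import Data.Nat.Tactic.RingSolver using (solve-∀)
open import Data.Integer as ℤ using (+_; +≤+; +<+)
open import Data.Fin as Fin using (Fin; toℕ)
open import Data.Fin.Properties using (toℕ<n)
open import Data.Vec using (Vec; []; _∷_; toList; sum; lookup)
open import Data.List using (List; []; _∷_; _++_; map; length)
open import Data.List.Properties
  using (∷-injectiveˡ; ∷-injectiveʳ; length-++; length-map; map-++; map-∘; map-id-local)
open import Data.List.Relation.Unary.All as All using (All; []; _∷_)
import Data.List.Relation.Unary.All.Properties as Allₚ
open import Data.List.Relation.Unary.AllPairs using ([]; _∷_)
open import Data.List.Relation.Unary.Any using (here; there)
open import Data.List.Membership.Propositional using (_∈_; _∉_)
open import Data.List.Membership.Propositional.Properties
  using (∈-++⁻; ∈-++⁺ˡ; ∈-++⁺ʳ; ∈-map⁺; ∈-map⁻)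
open import Data.List.Membership.DecPropositional _≟_ using (_∈?_)
open import Data.List.Relation.Unary.Unique.Propositional using (Unique)
open import Data.List.Relation.Unary.Unique.Propositional.Properties using (map⁻; ++⁺)
open import Data.List.Relation.Binary.Disjoint.Propositional using (Disjoint)
open import Data.List.Relation.Binary.Permutation.Propositional
  using (_↭_; ↭-refl; ↭-prep; ↭-sym; ↭⇒↭ₛ; module PermutationReasoning)
open import Data.List.Relation.Binary.Permutation.Propositional.Properties as ↭
  using (∈-resp-↭)
import Data.List.Relation.Binary.Permutation.Setoid.Properties as PermutationSetoid
open import Data.Product as Product using (∃-syntax; _×_; _,_; proj₁; proj₂)
open import Data.Product.Relation.Binary.Lex.Strict using (×-Lex)
open import Data.Sum using (_⊎_; inj₁; inj₂)
open import Data.Unit using (tt)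
open import Relation.Nullary using (yes; no; contradiction)
open import Relation.Binary.PropositionalEquality

private
  variable
    m : ℕ

+-suc-assoc : ∀ o a b → o + suc a + b ≡ o + (a + suc b)
+-suc-assoc = solve-∀

range : ℕ → ℕ → List ℕ
range o zero    = []
range o (suc n) = o ∷ range (suc o) n

length-range : ∀ o n → length (range o n) ≡ n
length-range o zero    = refl
length-range o (suc n) = cong suc (length-range (suc o) n)

range-++ : ∀ o a b → range o (a + b) ≡ range o a ++ range (o + a) b
range-++ o zero    b rewrite +-identityʳ o = refl
range-++ o (suc a) b rewrite +-suc o a     = cong (o ∷_) (range-++ (suc o) a b)

map-range-suc : ∀ {A : Set} (f : ℕ → A) o n →
                map f (range (suc o) n) ≡ map (λ x → f (suc x)) (range o n)
map-range-suc f o zero    = refl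
map-range-suc f o (suc n) = cong (f (suc o) ∷_) (map-range-suc f (suc o) n)

++-injective : ∀ {A : Set} {xs xs′ ys ys′ : List A} → length xs ≡ length xs′ →
               xs ++ ys ≡ xs′ ++ ys′ → xs ≡ xs′ × ys ≡ ys′
++-injective {xs = []}     {[]}       _ eq = refl , eq
++-injective {xs = x ∷ xs} {x′ ∷ xs′} len eq =
  let xs≡ , ys≡ = ++-injective (suc-injective len) (∷-injectiveʳ eq)
  in cong₂ _∷_ (∷-injectiveˡ eq) xs≡ , ys≡

Unique-++⁻ : ∀ {A : Set} (xs : List A) {ys} →
             Unique (xs ++ ys) → Unique xs × Unique ys × Disjoint xs ys
Unique-++⁻ []       u          = [] , u , λ { (() , _) }
Unique-++⁻ (x ∷ xs) (x∉ ∷ u) with Unique-++⁻ xs u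
... | uxs , uys , disjoint = Allₚ.++⁻ˡ xs x∉ ∷ uxs , uys , λ where
  (here refl , x∈ys) → All.lookup (Allₚ.++⁻ʳ xs x∉) x∈ys refl
  (there v∈xs , v∈ys) → disjoint (v∈xs , v∈ys)

Unique-resp-↭ : ∀ {A : Set} {xs ys : List A} → xs ↭ ys → Unique xs → Unique ys
Unique-resp-↭ {A} p = PermutationSetoid.Unique-resp-↭ (setoid A) (↭⇒↭ₛ p)

Unique-map⁺-retract : ∀ {A B : Set} {f : A → B} (g : B → A) {xs} →
                      All (λ x → g (f x) ≡ x) xs → Unique xs → Unique (map f xs)
Unique-map⁺-retract {f = f} g {xs} retract u =
  map⁻ {f = g} (subst Unique (sym (trans (sym (map-∘ xs)) (map-id-local retract))) u)

-- Leaf labels and the block/offset coordinates of a label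

-- ℓ s cs o = s + o + c₁ + ⋯ + c_o, the (o+1)-st entry of ellsFrom s (toList cs).
ℓ : ∀ {m} → ℕ → Vec ℕ m → ℕ → ℕ
ℓ s []       o       = s
ℓ s (c ∷ cs) zero    = s
ℓ s (c ∷ cs) (suc o) = ℓ (s + suc c) cs o

-- A label k ≥ s is ℓ s cs o + j for a unique block o and offset j ≤ c_o (the last block
-- being unbounded); the leaf labels are those with offset 0.
position : ∀ {m} → ℕ → Vec ℕ m → ℕ → ℕ × ℕ
position s []       k = 0 , k ∸ s
position s (c ∷ cs) k with k <? s + suc c
... | yes _ = 0 , k ∸ s
... | no  _ = Product.map₁ suc (position (s + suc c) cs k)

block offset : ∀ {m} → ℕ → Vec ℕ m → ℕ → ℕ
block  s cs k = proj₁ (position s cs k)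
offset s cs k = proj₂ (position s cs k)

ℓ-zero : ∀ s (cs : Vec ℕ m) → ℓ s cs 0 ≡ s
ℓ-zero s []       = refl
ℓ-zero s (c ∷ cs) = refl

s≤ℓ : ∀ s (cs : Vec ℕ m) o → s ≤ ℓ s cs o
s≤ℓ s []       o       = ≤-refl
s≤ℓ s (c ∷ cs) zero    = ≤-refl
s≤ℓ s (c ∷ cs) (suc o) = ≤-trans (m≤m+n s (suc c)) (s≤ℓ (s + suc c) cs o)

ℓ-mono : ∀ s (cs : Vec ℕ m) {o p} → o ≤ p → ℓ s cs o ≤ ℓ s cs p
ℓ-mono s []       _                  = ≤-refl
ℓ-mono s (c ∷ cs) {zero}  {p}     _ = s≤ℓ s (c ∷ cs) p
ℓ-mono s (c ∷ cs) {suc o} {suc p} (s≤s o≤p) = ℓ-mono (s + suc c) cs o≤p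

ℓ-suc : ∀ s (cs : Vec ℕ m) (o : Fin m) →
        ℓ s cs (suc (toℕ o)) ≡ ℓ s cs (toℕ o) + suc (lookup cs o)
ℓ-suc s (c ∷ cs) Fin.zero    = ℓ-zero (s + suc c) cs
ℓ-suc s (c ∷ cs) (Fin.suc o) = ℓ-suc (s + suc c) cs o

ℓ-last : ∀ s (cs : Vec ℕ m) → ℓ s cs m ≡ s + m + sum cs
ℓ-last s []       = sym (trans (+-identityʳ (s + 0)) (+-identityʳ s))
ℓ-last s (c ∷ cs) = trans (ℓ-last (s + suc c) cs) (solve s c _ (sum cs))
  where
  solve : ∀ s c m t → s + suc c + m + t ≡ s + suc m + (c + t)
  solve = solve-∀

ellsFrom-ℓ : ∀ s (cs : Vec ℕ m) → ellsFrom s (toList cs) ≡ map (ℓ s cs) (range 0 (suc m))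
ellsFrom-ℓ         s []       = refl
ellsFrom-ℓ {suc m} s (c ∷ cs) = cong (s ∷_)
  (trans (ellsFrom-ℓ (s + suc c) cs) (sym (map-range-suc (ℓ s (c ∷ cs)) 0 (suc m))))

length-ellsFrom : ∀ s (cs : Vec ℕ m) → length (ellsFrom s (toList cs)) ≡ suc m
length-ellsFrom s []       = refl
length-ellsFrom s (c ∷ cs) = cong suc (length-ellsFrom (s + suc c) cs)

∈ellsFrom⇒≥ : ∀ s (cs : Vec ℕ m) {x} → x ∈ ellsFrom s (toList cs) → s ≤ x
∈ellsFrom⇒≥ s []       (here refl) = ≤-refl
∈ellsFrom⇒≥ s (c ∷ cs) (here refl) = ≤-refl
∈ellsFrom⇒≥ s (c ∷ cs) (there x∈)  = ≤-trans (m≤m+n s (suc c)) (∈ellsFrom⇒≥ (s + suc c) cs x∈)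

∈ellsFrom⇒≤ : ∀ s (cs : Vec ℕ m) {x} → x ∈ ellsFrom s (toList cs) → x ≤ ℓ s cs m
∈ellsFrom⇒≤ s []       (here refl) = ≤-refl
∈ellsFrom⇒≤ s (c ∷ cs) (here refl) = s≤ℓ s (c ∷ cs) (suc _)
∈ellsFrom⇒≤ s (c ∷ cs) (there x∈)  = ∈ellsFrom⇒≤ (s + suc c) cs x∈

ellsFrom-unique : ∀ s (cs : Vec ℕ m) → Unique (ellsFrom s (toList cs))
ellsFrom-unique s []       = [] ∷ []
ellsFrom-unique s (c ∷ cs) =
  All.tabulate (λ x∈ → <⇒≢ (<-≤-trans (m<m+n s z<s) (∈ellsFrom⇒≥ (s + suc c) cs x∈)))
  ∷ ellsFrom-unique (s + suc c) cs

ℓ-block+offset : ∀ s (cs : Vec ℕ m) k → s ≤ k →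
                 ℓ s cs (block s cs k) + offset s cs k ≡ k
ℓ-block+offset s []       k s≤k = m+[n∸m]≡n s≤k
ℓ-block+offset s (c ∷ cs) k s≤k with k <? s + suc c
... | yes _  = m+[n∸m]≡n s≤k
... | no  k≮ = ℓ-block+offset (s + suc c) cs k (≮⇒≥ k≮)

position-ℓ+ : ∀ s (cs : Vec ℕ m) (o : Fin m) j → j ≤ lookup cs o →
              position s cs (ℓ s cs (toℕ o) + j) ≡ (toℕ o , j)
position-ℓ+ s (c ∷ cs) Fin.zero j j≤c with s + j <? s + suc c
... | yes _  = cong (0 ,_) (m+n∸m≡n s j)
... | no  k≮ = contradiction (+-monoʳ-< s (s≤s j≤c)) k≮
position-ℓ+ s (c ∷ cs) (Fin.suc o) j j≤c with ℓ (s + suc c) cs (toℕ o) + j <? s + suc c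
... | yes k< = contradiction k< (≤⇒≯ (≤-trans (s≤ℓ (s + suc c) cs (toℕ o)) (m≤m+n _ j)))
... | no  _  = cong (Product.map₁ suc) (position-ℓ+ (s + suc c) cs o j j≤c)

∈ellsFrom⇒offset≡0 : ∀ s (cs : Vec ℕ m) {x} → x ∈ ellsFrom s (toList cs) → offset s cs x ≡ 0
∈ellsFrom⇒offset≡0 s []           (here refl) = n∸n≡0 s
∈ellsFrom⇒offset≡0 s (c ∷ cs) {x} (here refl) with x <? x + suc c
... | yes _  = n∸n≡0 x
... | no  x≮ = contradiction (m<m+n x z<s) x≮
∈ellsFrom⇒offset≡0 s (c ∷ cs) {x} (there x∈) with x <? s + suc c
... | yes x< = contradiction x< (≤⇒≯ (∈ellsFrom⇒≥ (s + suc c) cs x∈))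
... | no  _  = ∈ellsFrom⇒offset≡0 (s + suc c) cs x∈

offset≡0⇒∈ellsFrom : ∀ s (cs : Vec ℕ m) k → s ≤ k → offset s cs k ≡ 0 →
                     k ∈ ellsFrom s (toList cs)
offset≡0⇒∈ellsFrom s []       k s≤k eq = here (≤-antisym (m∸n≡0⇒m≤n eq) s≤k)
offset≡0⇒∈ellsFrom s (c ∷ cs) k s≤k eq with k <? s + suc c
... | yes _  = here (≤-antisym (m∸n≡0⇒m≤n eq) s≤k)
... | no  k≮ = there (offset≡0⇒∈ellsFrom (s + suc c) cs k (≮⇒≥ k≮) eq)

ℓ<⇒≤block : ∀ s (cs : Vec ℕ m) o k → o ≤ m → ℓ s cs o < k → o ≤ block s cs k
ℓ<⇒≤block s cs       zero    k _         _   = z≤n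
ℓ<⇒≤block s (c ∷ cs) (suc o) k (s≤s o≤m) ℓ<k with k <? s + suc c
... | yes k< = contradiction k< (≤⇒≯ (≤-trans (s≤ℓ (s + suc c) cs o) (<⇒≤ ℓ<k)))
... | no  _  = s≤s (ℓ<⇒≤block (s + suc c) cs o k o≤m ℓ<k)

<ℓ⇒block< : ∀ s (cs : Vec ℕ m) p k → s ≤ k → k < ℓ s cs p → block s cs k < p
<ℓ⇒block< s []       p       k s≤k k< = contradiction k< (≤⇒≯ s≤k)
<ℓ⇒block< s (c ∷ cs) zero    k s≤k k< = contradiction k< (≤⇒≯ s≤k)
<ℓ⇒block< s (c ∷ cs) (suc p) k s≤k k< with k <? s + suc c
... | yes _  = z<s
... | no  k≮ = s<s (<ℓ⇒block< (s + suc c) cs p k (≮⇒≥ k≮) k<)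

offset≤lookup : ∀ s (cs : Vec ℕ m) k → s ≤ k → k ≤ ℓ s cs m → 1 ≤ offset s cs k →
                ∃[ o ] toℕ o ≡ block s cs k × offset s cs k ≤ lookup cs o
offset≤lookup s []       k s≤k k≤ 1≤ = contradiction (sym (m≤n⇒m∸n≡0 k≤)) (<⇒≢ 1≤)
offset≤lookup s (c ∷ cs) k s≤k k≤ 1≤ with k <? s + suc c
... | yes k< = Fin.zero , refl , (begin
  k ∸ s           ≤⟨ ∸-monoˡ-≤ s (≤-pred (subst (suc k ≤_) (+-suc s c) k<)) ⟩
  s + c ∸ s       ≡⟨ m+n∸m≡n s c ⟩
  c               ∎)
  where open ≤-Reasoning
... | no  k≮ =
  let o , eq , offset≤ = offset≤lookup (s + suc c) cs k (≮⇒≥ k≮) k≤ 1≤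
  in Fin.suc o , cong suc eq , offset≤

position-mono : ∀ s (cs : Vec ℕ m) a b → s ≤ a → a < b →
                ×-Lex _≡_ _<_ _<_ (position s cs a) (position s cs b)
position-mono s []       a b s≤a a<b = inj₂ (refl , ∸-monoˡ-< a<b s≤a)
position-mono s (c ∷ cs) a b s≤a a<b with a <? s + suc c | b <? s + suc c
... | yes _  | yes _  = inj₂ (refl , ∸-monoˡ-< a<b s≤a)
... | yes _  | no  _  = inj₁ z<s
... | no  a≮ | yes b< = contradiction (<-trans a<b b<) a≮
... | no  a≮ | no  _  with position-mono (s + suc c) cs a b (≮⇒≥ a≮) a<b
...   | inj₁ lt        = inj₁ (s<s lt)
...   | inj₂ (eq , lt) = inj₂ (cong suc eq , lt)

intLabels : LTree → List ℕ
intLabels (leaf _)     = []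
intLabels (node l a r) = intLabels l ++ a ∷ intLabels r

allLabels↭ : ∀ t → allLabels t ↭ intLabels t ++ leafLabels t
allLabels↭ (leaf a)     = ↭-refl
allLabels↭ (node l a r) = begin
  allLabels l ++ a ∷ allLabels r  ↭⟨ ↭.++⁺ (allLabels↭ l) (↭-prep a (allLabels↭ r)) ⟩
  (I l ++ L l) ++ a ∷ I r ++ L r  ↭⟨ ↭.++-assoc (I l) (L l) _ ⟩
  I l ++ L l ++ (a ∷ I r) ++ L r  ↭⟨ ↭.++⁺ˡ (I l) (↭.shifts (L l) (a ∷ I r)) ⟩
  I l ++ (a ∷ I r) ++ L l ++ L r  ↭⟨ ↭.++-assoc (I l) (a ∷ I r) _ ⟨
  (I l ++ a ∷ I r) ++ L l ++ L r  ∎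
  where
  open PermutationReasoning
  I L : LTree → List ℕ
  I = intLabels
  L = leafLabels

∈allLabels⁻ : ∀ t {x} → x ∈ allLabels t → x ∈ intLabels t ⊎ x ∈ leafLabels t
∈allLabels⁻ t x∈ = ∈-++⁻ (intLabels t) (∈-resp-↭ (allLabels↭ t) x∈)

∈intLabels⇒∈allLabels : ∀ t {x} → x ∈ intLabels t → x ∈ allLabels t
∈intLabels⇒∈allLabels t x∈ = ∈-resp-↭ (↭-sym (allLabels↭ t)) (∈-++⁺ˡ x∈)

∈leafLabels⇒∈allLabels : ∀ t {x} → x ∈ leafLabels t → x ∈ allLabels t
∈leafLabels⇒∈allLabels t x∈ = ∈-resp-↭ (↭-sym (allLabels↭ t)) (∈-++⁺ʳ (intLabels t) x∈)

-- Labels versus symbols of Z_c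

-- Blocks are counted from 0, the first coordinate of Z_c from 1.
toZBar : ℕ × ℕ → ZBar
toZBar (b , j) = + suc b , j

Lex⇒<Z̄ : ∀ {x y} → ×-Lex _≡_ _<_ _<_ x y → toZBar x <Z̄ toZBar y
Lex⇒<Z̄ {_ , _} {_ , _} (inj₁ b<b′)          = fst< (+<+ (s<s b<b′))
Lex⇒<Z̄ {_ , _} {_ , _} (inj₂ (refl , j<j′)) = snd< j<j′

module Labelling {m : ℕ} (c : Vec ℕ m) where

  ell : ℕ → ℕ
  ell = ℓ 1 c

  symbol : ℕ → ZBar
  symbol k = toZBar (position 1 c k)

  -- junk value 0 on symbols (i , j) with i ≤ 0, none of which lies in Z_c
  label : ZBar → ℕ
  label (+ suc b , j) = ell b + j
  label _             = 0

  label-symbol : ∀ {k} → 1 ≤ k → label (symbol k) ≡ k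
  label-symbol {k} 1≤k = ℓ-block+offset 1 c k 1≤k

  symbol-label : ∀ {x} → InZc c x → symbol (label x) ≡ x
  symbol-label {_ , j} (o , refl , _ , j≤c) = cong toZBar (position-ℓ+ 1 c o j j≤c)

  symbol-mono : ∀ {a b} → 1 ≤ a → a < b → symbol a <Z̄ symbol b
  symbol-mono {a} {b} 1≤a a<b = Lex⇒<Z̄ (position-mono 1 c a b 1≤a a<b)

  label<ell-suc : ∀ (o : Fin m) {j} → j ≤ lookup c o → ell (toℕ o) + j < ell (suc (toℕ o))
  label<ell-suc o {j} j≤c =
    subst (ell (toℕ o) + j <_) (sym (ℓ-suc 1 c o)) (+-monoʳ-< (ell (toℕ o)) (s≤s j≤c))

  ell<label : ∀ {o x} → InZc c x → + suc o ℤ.≤ proj₁ x → ell o < label x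
  ell<label {x = _ , j} (b , refl , 1≤j , _) (+≤+ (s≤s o≤b)) =
    <-≤-trans (m<m+n (ell _) 1≤j) (+-monoˡ-≤ j (ℓ-mono 1 c o≤b))

  label<ell : ∀ {p x} → InZc c x → proj₁ x ℤ.≤ + p → label x < ell p
  label<ell (b , refl , _ , j≤c) (+≤+ b<p) = <-≤-trans (label<ell-suc b j≤c) (ℓ-mono 1 c b<p)

  label-mono : ∀ {x y} → InZc c x → InZc c y → x <Z̄ y → label x < label y
  label-mono {_ , j} {_ , j′} x∈ y∈ (fst< i<i′) with x∈ | y∈ | i<i′
  ... | b , refl , _ , j≤c | _ , refl , _ | +<+ (s<s b<b′) =
    <-≤-trans (label<ell-suc b j≤c) (≤-trans (ℓ-mono 1 c b<b′) (m≤m+n _ j′))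
  label-mono (b , refl , _) _ (snd< j<j′) = +-monoʳ-< (ell (toℕ b)) j<j′

  label-range : ∀ {x} → InZc c x → 1 ≤ label x × label x ≤ ell m
  label-range {_ , j} x∈@(b , refl , _) =
    ≤-trans (s≤ℓ 1 c (toℕ b)) (m≤m+n _ j) , <⇒≤ (label<ell x∈ (+≤+ (toℕ<n b)))

  label∉ells : ∀ {x} → InZc c x → label x ∉ ells c
  label∉ells x∈@(_ , _ , 1≤j , _) l∈ =
    <⇒≢ 1≤j (trans (sym (∈ellsFrom⇒offset≡0 1 c l∈)) (cong proj₂ (symbol-label x∈)))

  InnerLabel : ℕ → Set
  InnerLabel a = 1 ≤ a × a ≤ ell m × a ∉ ells c

  symbol∈Zc : ∀ {k} → InnerLabel k → InZc c (symbol k)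
  symbol∈Zc {k} (1≤k , k≤ , k∉) =
    let 1≤offset = n≢0⇒n>0 (λ eq → k∉ (offset≡0⇒∈ellsFrom 1 c k 1≤k eq))
        o , o≡ , offset≤ = offset≤lookup 1 c k 1≤k k≤ 1≤offset
    in o , cong (λ b → + suc b) (sym o≡) , 1≤offset , offset≤

  -- Removing and re-attaching leaves

  prune : LTree → RTree
  prune (leaf _)     = empty
  prune (node l a r) = node (prune l) (symbol a) (prune r)

  complete : ℕ → RTree → LTree
  complete o empty        = leaf (ell o)
  complete o (node l x r) = node (complete o l) (label x) (complete (o + suc (size l)) r)

  LeavesFrom : ℕ → LTree → Set
  LeavesFrom o t = leafLabels t ≡ map ell (range o (suc (size (prune t))))

  length-leafLabels : ∀ t → length (leafLabels t) ≡ suc (size (prune t))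
  length-leafLabels (leaf _)     = refl
  length-leafLabels (node l a r) =
    trans (length-++ (leafLabels l)) (cong₂ _+_ (length-leafLabels l) (length-leafLabels r))

  LeavesFrom-node⁻ : ∀ {o} l {a} r → LeavesFrom o (node l a r) →
                     LeavesFrom o l × LeavesFrom (o + suc (size (prune l))) r
  LeavesFrom-node⁻ {o} l r eq = ++-injective
    (trans (length-leafLabels l) (sym (trans (length-map ell (range o sl)) (length-range o sl))))
    (trans eq (trans (cong (map ell) (range-++ o sl sr)) (map-++ ell (range o sl) _)))
    where
    sl = suc (size (prune l))
    sr = suc (size (prune r))

  leftmostLeaf rightmostLeaf : LTree → ℕ
  leftmostLeaf (leaf a)     = a
  leftmostLeaf (node l _ _) = leftmostLeaf l
  rightmostLeaf (leaf a)     = a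
  rightmostLeaf (node _ _ r) = rightmostLeaf r

  leftmostLeaf≤root : ∀ {t} → NodeCondition t → leftmostLeaf t ≤ rootLabel t
  leftmostLeaf≤root (leaf a)           = ≤-refl
  leftmostLeaf≤root (node l<a _ ncl _) = ≤-trans (leftmostLeaf≤root ncl) (<⇒≤ l<a)

  root≤rightmostLeaf : ∀ {t} → NodeCondition t → rootLabel t ≤ rightmostLeaf t
  root≤rightmostLeaf (leaf a)           = ≤-refl
  root≤rightmostLeaf (node _ a<r _ ncr) = ≤-trans (<⇒≤ a<r) (root≤rightmostLeaf ncr)

  leftmostLeaf-from : ∀ o t → LeavesFrom o t → leftmostLeaf t ≡ ell o
  leftmostLeaf-from o (leaf a)     eq = ∷-injectiveˡ eq
  leftmostLeaf-from o (node l a r) eq =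
    leftmostLeaf-from o l (proj₁ (LeavesFrom-node⁻ l {a} r eq))

  rightmostLeaf-from : ∀ o t → LeavesFrom o t → rightmostLeaf t ≡ ell (o + size (prune t))
  rightmostLeaf-from o (leaf a)     eq = trans (∷-injectiveˡ eq) (cong ell (sym (+-identityʳ o)))
  rightmostLeaf-from o (node l a r) eq =
    trans (rightmostLeaf-from _ r (proj₂ (LeavesFrom-node⁻ l {a} r eq)))
          (cong ell (+-suc-assoc o _ _))

  prune-LeftOK : ∀ l {a} → rootLabel l < a → All InnerLabel (intLabels l) →
                 LeftOK (prune l) (symbol a)
  prune-LeftOK (leaf _)       _   _     = tt
  prune-LeftOK (node ll b lr) b<a inner with Allₚ.++⁻ʳ (intLabels ll) inner
  ... | (1≤b , _) ∷ _ = symbol-mono 1≤b b<a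

  prune-RightOK : ∀ r {a} → 1 ≤ a → a < rootLabel r → RightOK (symbol a) (prune r)
  prune-RightOK (leaf _)     _   _   = tt
  prune-RightOK (node _ _ _) 1≤a a<b = symbol-mono 1≤a a<b

  -- The leaves below the root a of t are ell o, …, ell (o + size); the node condition forces
  -- ell o < a < ell (o + size), which puts the block of a in INT.
  prune-LBSAt : ∀ o t → NodeCondition t → LeavesFrom o t → o + size (prune t) ≤ m →
                All InnerLabel (intLabels t) → LBSAt o (prune t)
  prune-LBSAt o (leaf _)     _                      _      _     _     = empty
  prune-LBSAt o (node l a r) (node l<a a<r ncl ncr) leaves bound inner
    with Allₚ.++⁻ (intLabels l) inner
  ... | inner-l , inner-a ∷ inner-r =
    node (proj₁ (proj₂ (proj₂ (symbol∈Zc inner-a))))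
         (prune-LeftOK l l<a inner-l) (prune-RightOK r (proj₁ inner-a) a<r)
         (+≤+ (s≤s o≤block)) (+≤+ block<)
         (prune-LBSAt o l ncl leaves-l (≤-trans (+-monoʳ-≤ o (m≤m+n sl _)) bound) inner-l)
         (prune-LBSAt (o + suc sl) r ncr leaves-r (subst (_≤ m) (sym (+-suc-assoc o sl sr)) bound) inner-r)
    where
    sl = size (prune l)
    sr = size (prune r)
    leaves-l = proj₁ (LeavesFrom-node⁻ l {a} r leaves)
    leaves-r = proj₂ (LeavesFrom-node⁻ l {a} r leaves)
    ell<a : ell o < a
    ell<a = begin-strict
      ell o            ≡⟨ leftmostLeaf-from o l leaves-l ⟨
      leftmostLeaf l   ≤⟨ leftmostLeaf≤root ncl ⟩
      rootLabel l      <⟨ l<a ⟩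
      a                ∎
      where open ≤-Reasoning
    a<ell : a < ell (o + (sl + suc sr))
    a<ell = begin-strict
      a                         <⟨ a<r ⟩
      rootLabel r               ≤⟨ root≤rightmostLeaf ncr ⟩
      rightmostLeaf r           ≡⟨ rightmostLeaf-from _ r leaves-r ⟩
      ell (o + suc sl + sr)     ≡⟨ cong ell (+-suc-assoc o sl sr) ⟩
      ell (o + (sl + suc sr))   ∎
      where open ≤-Reasoning
    o≤block : o ≤ block 1 c a
    o≤block = ℓ<⇒≤block 1 c o a (≤-trans (m≤m+n o _) bound) ell<a
    block< : block 1 c a < o + (sl + suc sr)
    block< = <ℓ⇒block< 1 c _ a (proj₁ inner-a) a<ell

  prune-decorations : ∀ t → decorations (prune t) ≡ map symbol (intLabels t)
  prune-decorations (leaf _)     = refl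
  prune-decorations (node l a r) =
    trans (cong₂ (λ u v → u ++ symbol a ∷ v) (prune-decorations l) (prune-decorations r))
          (sym (map-++ symbol (intLabels l) _))

  complete-intLabels : ∀ o t → intLabels (complete o t) ≡ map label (decorations t)
  complete-intLabels o empty        = refl
  complete-intLabels o (node l x r) =
    trans (cong₂ (λ u v → u ++ label x ∷ v) (complete-intLabels o l) (complete-intLabels _ r))
          (sym (map-++ label (decorations l) _))

  complete-leafLabels : ∀ o t → leafLabels (complete o t) ≡ map ell (range o (suc (size t)))
  complete-leafLabels o empty        = refl
  complete-leafLabels o (node l x r) = begin
    leafLabels (complete o l) ++ leafLabels (complete (o + suc (size l)) r)
      ≡⟨ cong₂ _++_ (complete-leafLabels o l) (complete-leafLabels _ r) ⟩
    map ell (range o (suc (size l))) ++ map ell (range (o + suc (size l)) (suc (size r)))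
      ≡⟨ map-++ ell (range o (suc (size l))) _ ⟨
    map ell (range o (suc (size l)) ++ range (o + suc (size l)) (suc (size r)))
      ≡⟨ cong (map ell) (range-++ o (suc (size l)) (suc (size r))) ⟨
    map ell (range o (suc (size l) + suc (size r)))
      ∎
    where open ≡-Reasoning

  complete-prune : ∀ o t → LeavesFrom o t → All (1 ≤_) (intLabels t) → complete o (prune t) ≡ t
  complete-prune o (leaf a)     leaves _  = cong leaf (sym (∷-injectiveˡ leaves))
  complete-prune o (node l a r) leaves 1≤ with Allₚ.++⁻ (intLabels l) 1≤
  ... | 1≤l , 1≤a ∷ 1≤r =
    cong₂ (λ u (b , v) → node u b v) (complete-prune o l leaves-l 1≤l)
      (cong₂ _,_ (label-symbol 1≤a) (complete-prune _ r leaves-r 1≤r))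
    where
    leaves-l = proj₁ (LeavesFrom-node⁻ l {a} r leaves)
    leaves-r = proj₂ (LeavesFrom-node⁻ l {a} r leaves)

  prune-complete : ∀ o t → All (InZc c) (decorations t) → prune (complete o t) ≡ t
  prune-complete o empty        _     = refl
  prune-complete o (node l x r) x∈Zc with Allₚ.++⁻ (decorations l) x∈Zc
  ... | l∈Zc , x∈ ∷ r∈Zc =
    cong₂ (λ u (y , v) → node u y v) (prune-complete o l l∈Zc)
      (cong₂ _,_ (symbol-label x∈) (prune-complete _ r r∈Zc))

  complete-root<label : ∀ o l {x} → LeftOK l x → + suc o ℤ.≤ proj₁ x → InZc c x →
                        All (InZc c) (decorations l) → rootLabel (complete o l) < label x
  complete-root<label o empty          _   o<i x∈ _    = ell<label x∈ o<i
  complete-root<label o (node ll y lr) y<x _   x∈ l∈Zc with Allₚ.++⁻ʳ (decorations ll) l∈Zc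
  ... | y∈ ∷ _ = label-mono y∈ x∈ y<x

  label<complete-root : ∀ o r {x} → RightOK x r → proj₁ x ℤ.≤ + (o + size r) → InZc c x →
                        All (InZc c) (decorations r) → label x < rootLabel (complete o r)
  label<complete-root o empty {x} _ i≤ x∈ _ =
    label<ell x∈ (subst (λ p → proj₁ x ℤ.≤ + p) (+-identityʳ o) i≤)
  label<complete-root o (node rl y rr) x<y _ x∈ r∈Zc with Allₚ.++⁻ʳ (decorations rl) r∈Zc
  ... | y∈ ∷ _ = label-mono x∈ y∈ x<y

  complete-NodeCondition : ∀ o t → LBSAt o t → All (InZc c) (decorations t) →
                           NodeCondition (complete o t)
  complete-NodeCondition o empty        _ _ = leaf _
  complete-NodeCondition o (node l x r) (node _ x>l x<r o<i i≤ lbs-l lbs-r) x∈Zc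
    with Allₚ.++⁻ (decorations l) x∈Zc
  ... | l∈Zc , x∈ ∷ r∈Zc =
    node (complete-root<label o l x>l o<i x∈ l∈Zc)
         (label<complete-root (o + suc (size l)) r x<r i≤′ x∈ r∈Zc)
         (complete-NodeCondition o l lbs-l l∈Zc) (complete-NodeCondition _ r lbs-r r∈Zc)
    where
    i≤′ = subst (λ p → proj₁ x ℤ.≤ + p) (sym (+-suc-assoc o (size l) (size r))) i≤

module Bijection {m : ℕ} (c : Vec ℕ m) (sum≡m : sum c ≡ m) where
  open Labelling c

  ell-last : ell m ≡ 2 * m + 1
  ell-last = trans (ℓ-last 1 c) (trans (cong (λ s → 1 + m + s) sum≡m) (solve m))
    where
    solve : ∀ m → 1 + m + m ≡ 2 * m + 1
    solve = solve-∀

  label-bounds : ∀ {x} → InZc c x → 1 ≤ label x × label x ≤ 2 * m + 1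
  label-bounds {x} x∈ = Product.map₂ (subst (label x ≤_) ell-last) (label-range x∈)

  innerLabel : ∀ {k} → 1 ≤ k → k ≤ 2 * m + 1 → k ∉ ells c → InnerLabel k
  innerLabel {k} 1≤k k≤ k∉ = 1≤k , subst (k ≤_) (sym ell-last) k≤ , k∉

  size-prune : ∀ {t} → IsPairTLR m c t → size (prune t) ≡ m
  size-prune {t} (_ , _ , _ , _ , leaves≡) = suc-injective (begin
    suc (size (prune t))  ≡⟨ length-leafLabels t ⟨
    length (leafLabels t) ≡⟨ cong length leaves≡ ⟩
    length (ells c)       ≡⟨ length-ellsFrom 1 c ⟩
    suc m                 ∎)
    where open ≡-Reasoning

  leavesFrom0 : ∀ {t} → IsPairTLR m c t → LeavesFrom 0 t
  leavesFrom0 pair@(_ , _ , _ , _ , leaves≡) = trans leaves≡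
    (trans (ellsFrom-ℓ 1 c) (cong (λ n → map ell (range 0 (suc n))) (sym (size-prune pair))))

  unique-intLabels : ∀ {t} → IsPairTLR m c t →
                     Unique (intLabels t) × Disjoint (intLabels t) (leafLabels t)
  unique-intLabels {t} (_ , unique , _) =
    let u , _ , disjoint = Unique-++⁻ (intLabels t) (Unique-resp-↭ (allLabels↭ t) unique)
    in u , disjoint

  innerLabels : ∀ {t} → IsPairTLR m c t → All InnerLabel (intLabels t)
  innerLabels {t} pair@(_ , _ , inRange , _ , leaves≡) = All.tabulate λ {a} a∈ →
    let 1≤a , a≤ = All.lookup inRange (∈intLabels⇒∈allLabels t a∈)
    in innerLabel 1≤a a≤ λ a∈ells →
         proj₂ (unique-intLabels pair) (a∈ , subst (a ∈_) (sym leaves≡) a∈ells)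

  prune-IsPairP : ∀ t → IsPairTLR m c t → IsPairP m c (prune t)
  prune-IsPairP t pair@(nc , _ , _ , covers , leaves≡) =
    size-prune pair ,
    (prune-LBSAt 0 t nc (leavesFrom0 pair) (≤-reflexive (size-prune pair)) inner , unique) ,
    sub , sup
    where
    inner = innerLabels pair
    decorations≡ = prune-decorations t
    unique : Unique (decorations (prune t))
    unique = subst Unique (sym decorations≡)
      (Unique-map⁺-retract label (All.map (λ inn → label-symbol (proj₁ inn)) inner)
        (proj₁ (unique-intLabels pair)))
    sub : ∀ x → x ∈ decorations (prune t) → InZc c x
    sub x x∈ with ∈-map⁻ symbol (subst (x ∈_) decorations≡ x∈)
    ... | a , a∈ , refl = symbol∈Zc (All.lookup inner a∈)
    sup : ∀ x → InZc c x → x ∈ decorations (prune t)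
    sup x x∈Zc with ∈allLabels⁻ t (Product.uncurry (covers (label x)) (label-bounds x∈Zc))
    ... | inj₁ l∈I = subst (_∈ decorations (prune t)) (symbol-label x∈Zc)
                       (subst (symbol (label x) ∈_) (sym decorations≡) (∈-map⁺ symbol l∈I))
    ... | inj₂ l∈L = contradiction (subst (label x ∈_) leaves≡ l∈L) (label∉ells x∈Zc)

  decorations∈Zc : ∀ {t} → IsPairP m c t → All (InZc c) (decorations t)
  decorations∈Zc (_ , _ , sub , _) = All.tabulate (sub _)

  complete-IsPairTLR : ∀ t → IsPairP m c t → IsPairTLR m c (complete 0 t)
  complete-IsPairTLR t pair@(size≡ , (lbs , unique) , _ , sup) =
    complete-NodeCondition 0 t lbs inZc , unique-all , All.tabulate inRange , covers , leaves≡
    where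
    b = complete 0 t
    inZc = decorations∈Zc pair
    int≡ = complete-intLabels 0 t
    leaves≡ : leafLabels b ≡ ells c
    leaves≡ = trans (complete-leafLabels 0 t)
      (trans (cong (λ n → map ell (range 0 (suc n))) size≡) (sym (ellsFrom-ℓ 1 c)))
    disjoint : Disjoint (intLabels b) (leafLabels b)
    disjoint (x∈I , x∈L) with ∈-map⁻ label (subst (_ ∈_) int≡ x∈I)
    ... | y , y∈ , refl = label∉ells (All.lookup inZc y∈) (subst (_ ∈_) leaves≡ x∈L)
    unique-all : Unique (allLabels b)
    unique-all = Unique-resp-↭ (↭-sym (allLabels↭ b)) (++⁺
      (subst Unique (sym int≡) (Unique-map⁺-retract symbol (All.map symbol-label inZc) unique))
      (subst Unique (sym leaves≡) (ellsFrom-unique 1 c))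
      disjoint)
    inRange : ∀ {k} → k ∈ allLabels b → 1 ≤ k × k ≤ 2 * m + 1
    inRange {k} k∈ with ∈allLabels⁻ b k∈
    ... | inj₁ k∈I with ∈-map⁻ label (subst (_ ∈_) int≡ k∈I)
    ...   | y , y∈ , refl = label-bounds (All.lookup inZc y∈)
    inRange {k} k∈ | inj₂ k∈L = let k∈ells = subst (k ∈_) leaves≡ k∈L in
      ∈ellsFrom⇒≥ 1 c k∈ells , subst (k ≤_) ell-last (∈ellsFrom⇒≤ 1 c k∈ells)
    covers : ∀ k → 1 ≤ k → k ≤ 2 * m + 1 → k ∈ allLabels b
    covers k 1≤k k≤ with k ∈? ells c
    ... | yes k∈ = ∈leafLabels⇒∈allLabels b (subst (k ∈_) (sym leaves≡) k∈)
    ... | no  k∉ = ∈intLabels⇒∈allLabels b (subst (k ∈_) (sym int≡)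
      (subst (_∈ map label (decorations t)) (label-symbol 1≤k)
        (∈-map⁺ label (sup (symbol k) (symbol∈Zc (innerLabel 1≤k k≤ k∉))))))

proposition6p5 : (m : ℕ) (c : Vec ℕ m) → sum c ≡ m →
    SubsetBijection (IsPairTLR m c) (IsPairP m c)
proposition6p5 m c sum≡m = record
  { to        = λ (t , pair) → prune t , prune-IsPairP t pair
  ; from      = λ (t , pair) → complete 0 t , complete-IsPairTLR t pair
  ; to-cong   = λ _ _ → cong prune
  ; from-cong = λ _ _ → cong (complete 0)
  ; from-to   = λ (t , pair) →
      complete-prune 0 t (leavesFrom0 pair) (All.map proj₁ (innerLabels pair))
  ; to-from   = λ (t , pair) → prune-complete 0 t (decorations∈Zc pair)
  }
  where
  open Labelling c
  open Bijection c sum≡m
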